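{- Let $G, H$ be $I$-filtered groups (for some ordering $I$), let $i,j,k,l \in I$, and let $g_i \in \mathrm{poly}(H_I \to G_I^{+i})$, $g_j \in \mathrm{poly}(H_I \to G_I^{+j})$, $h_k \in H_k$, $h_l \in H_l$. Then $$\partial_{h_k}(g_i g_j) \equiv (\partial_{h_k} g_i)(\partial_{h_k} g_j) \mod \mathrm{poly}(H_I \to G_I^{+i+j+k})$$ and $$\partial_{h_k h_l}(g_i) \equiv (\partial_{h_k} g_i)(\partial_{h_l} g_i) \mod \mathrm{poly}(H_I \to G_I^{+i+k+l}).$$ If moreover $H$ is abelian, then also $$(\partial_{h_l} g_i)(\partial_{h_k} g_i) \equiv (\partial_{h_k} g_i)(\partial_{h_l} g_i) \mod \mathrm{poly}(H_I \to G_I^{+i+k+l}).$$ Here "$a \equiv b \mod N$" for maps $a,b \in \mathrm{poly}(H_I \to G_I)$ and a normal subgroup $N$ of the group $\mathrm{poly}(H_I \to G_I)$ means that $a$ and $b$ have the same image in the quotient group by $N$.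
   Context: An ordering is a set $I$ with a partial order $\prec$, a commutative associative operation $+$ with identity $0$, such that $0$ is the minimal element, $i\prec j$ implies $i+k\prec j+k$, and each initial segment $\{i : i \prec d\}$ is finite. An $I$-filtration of $G$ is a family $G_I = (G_i)_{i\in I}$ of subgroups with $G_i \supseteq G_j$ whenever $i \prec j$ and $[G_i,G_j]\subseteq G_{i+j}$ (with $[x,y]=x^{ -1}y^{ -1}xy$). The shifted filtration is $G_I^{+i} := (G_{j+i})_{j\in I}$. For $g : H \to G$ and $h\in H$, $\partial_h g(n) := g(hn)g(n)^{ -1}$. A map is polynomial with respect to $H_I$ and a filtration $(G'_i)$ of $G$ if $\partial_{h_1}\cdots\partial_{h_m}g(n) \in G'_{i_1+\dots+i_m}$ for all $m\geq 0$, $i_1,\dots,i_m\in I$, $h_j \in H_{i_j}$, $n \in H_0$; $\mathrm{poly}(H_I \to G_I^{+i})$ is the set of such maps for the filtration $G_I^{+i}$. The set $\mathrm{poly}(H_I\to G_I)$ is a group under pointwise multiplication, and each $\mathrm{poly}(H_I \to G_I^{+i})$ is a normal subgroup of it. -}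

module Defs where

open import Level using (Level; _⊔_; suc)
open import Data.Product using (Σ; ∃; _×_; _,_; proj₁; proj₂)
open import Data.List using (List; []; _∷_; foldr)
open import Data.List.Membership.Propositional using () renaming (_∈_ to _∈ₗ_)
open import Data.List.Relation.Unary.All using (All)
open import Relation.Binary.PropositionalEquality using (_≡_)
open import Relation.Binary.Structures using (IsPartialOrder)
open import Algebra.Structures using (IsCommutativeMonoid)
open import Algebra.Bundles using (Group)
open import Relation.Unary using (Pred; _∈_; _⊆_)

record Ordering : Set₁ where
  infixl 6 _+_
  field
    I              : Set
    _≼_            : I → I → Set
    ≼-isPartialOrder : IsPartialOrder _≡_ _≼_
    _+_            : I → I → I
    0#             : I
    +-isCommutativeMonoid : IsCommutativeMonoid _≡_ _+_ 0#
    0-minimal      : ∀ i → 0# ≼ i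
    +-mono         : ∀ {i j} k → i ≼ j → (i + k) ≼ (j + k)
    finite-segments : ∀ d → ∃ λ (xs : List I) → ∀ i → i ≼ d → i ∈ₗ xs

module _ {c ℓ} (G : Group c ℓ) where
  open Group G

  ⟦_,_⟧ : Carrier → Carrier → Carrier
  ⟦ x , y ⟧ = ((x ⁻¹ ∙ y ⁻¹) ∙ x) ∙ y

  record IsSubgroup {p} (P : Pred Carrier p) : Set (c ⊔ ℓ ⊔ p) where
    field
      resp : ∀ {x y} → x ≈ y → P x → P y
      ε∈   : P ε
      ∙∈   : ∀ {x y} → P x → P y → P (x ∙ y)
      ⁻¹∈  : ∀ {x} → P x → P (x ⁻¹)

  Congruent : ∀ {c' ℓ'} (H : Group c' ℓ') → (Group.Carrier H → Carrier) → Set (c' ⊔ ℓ' ⊔ ℓ)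
  Congruent H g = ∀ {x y} → Group._≈_ H x y → g x ≈ g y

record Filtration (O : Ordering) {c ℓ} (G : Group c ℓ) (p : Level) : Set (c ⊔ ℓ ⊔ suc p) where
  open Ordering O
  open Group G
  field
    F         : I → Pred Carrier p
    subgroup  : ∀ i → IsSubgroup G (F i)
    antitone  : ∀ {i j} → i ≼ j → F j ⊆ F i
    commutator : ∀ {i j x y} → x ∈ F i → y ∈ F j → ⟦_,_⟧ G x y ∈ F (i + j)

module _ {c ℓ c' ℓ'} (H : Group c' ℓ') (G : Group c ℓ) where
  private
    module G = Group G
    module H = Group H

  ∂ : H.Carrier → (H.Carrier → G.Carrier) → (H.Carrier → G.Carrier)
  ∂ h g n = g (h H.∙ n) G.∙ (g n) G.⁻¹

  _·_ : (H.Carrier → G.Carrier) → (H.Carrier → G.Carrier) → (H.Carrier → G.Carrier)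
  (a · b) n = a n G.∙ b n

  ∂* : {A : Set} → List (A × H.Carrier) → (H.Carrier → G.Carrier) → (H.Carrier → G.Carrier)
  ∂* []             g = g
  ∂* ((_ , h) ∷ hs) g = ∂ h (∂* hs g)

module _ (O : Ordering) where
  open Ordering O

  degree : ∀ {a} {A : Set a} → List (I × A) → I
  degree = foldr (λ p acc → proj₁ p + acc) 0#

  Poly : ∀ {c ℓ c' ℓ' p q} {H : Group c' ℓ'} {G : Group c ℓ} →
         Filtration O H p → (I → Pred (Group.Carrier G) q) →
         (Group.Carrier H → Group.Carrier G) → Set (c' ⊔ p ⊔ q)
  Poly {H = H} {G = G} FH G' g =
    ∀ (hs : List (I × Group.Carrier H)) →
    All (λ ih → proj₂ ih ∈ Filtration.F FH (proj₁ ih)) hs →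
    ∀ n → n ∈ Filtration.F FH 0# → ∂* H G hs g n ∈ G' (degree hs)

  shift : ∀ {c ℓ p} {G : Group c ℓ} → Filtration O G p → I → I → Pred (Group.Carrier G) p
  shift FG i j = Filtration.F FG (j + i)

  -- a ≡ b mod poly(H_I → G_I^{+m}) : a⁻¹ b lies in the normal subgroup poly(H_I → G_I^{+m})
  ≡-mod-poly : ∀ {c ℓ c' ℓ' p q} {H : Group c' ℓ'} {G : Group c ℓ} →
               Filtration O H p → Filtration O G q → I →
               (Group.Carrier H → Group.Carrier G) → (Group.Carrier H → Group.Carrier G) →
               Set (c' ⊔ p ⊔ q)
  ≡-mod-poly {H = H} {G = G} FH FG m a b =
    Poly {H = H} {G = G} FH (shift FG m) (λ n → Group._∙_ G (Group._⁻¹ G (a n)) (b n))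

module Submission where

-- Fix I-filtered groups G and H and call a formal expression built from
-- polynomial maps g ∈ poly(H_I → G_I^{+γ}) (an "atom of degree γ") by pointwise
-- products, inverses and commutators a *term*; its degree is computed by the
-- filtration rules (products and inverses keep the degree, a commutator adds
-- degrees, and the degree may always be lowered).  Two facts drive everything:
--   * the value of a term of degree D lies in G_D at every point of H_0;
--   * the derivative ∂_h of (the value of) a term of degree D, for h ∈ H_k, is
--     again (the value of) a term of degree D + k.  For atoms this is the fact
--     that ∂_h maps poly(H_I → G_I^{+γ}) into poly(H_I → G_I^{+γ+k}); for
--     products, inverses and commutators it is a group identity (a Leibniz rule).
-- Iterating the second fact and applying the first shows that every map
-- represented by a term of degree D lies in poly(H_I → G_I^{+D}).  Each of the
-- three congruences of the corollary then amounts to exhibiting a^{-1} b as the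
-- value of an explicit term of the required degree, which is again a group
-- identity.

open import Defs
open import Algebra.Bundles using (Group; CommutativeSemigroup)
open import Algebra.Definitions using (Commutative)
open import Algebra.Structures using (IsCommutativeMonoid)
open import Data.Bool as Bool using (Bool; true; false; not)
open import Data.Fin using (Fin)
open import Data.Fin.Patterns using (0F; 1F; 2F; 3F)
open import Data.Fin.Properties using (_≟_)
open import Data.List using (List; []; _∷_; _++_; [_]; foldr)
open import Data.List.Relation.Unary.All using (All; []; _∷_)
open import Data.List.Relation.Unary.All.Properties using (++⁺)
open import Data.Nat using (ℕ)
open import Data.Product using (_×_; _,_; proj₁; proj₂)
open import Data.Vec using (Vec; []; _∷_; lookup)
open import Level using (_⊔_; 0ℓ)
open import Relation.Binary.PropositionalEquality as ≡ using (_≡_)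
open import Relation.Binary.Structures using (IsPartialOrder)
open import Relation.Nullary using (yes; no)
open import Relation.Unary using (_∈_)

-- Equalities between group words are decided by reducing words in the free
-- group on the variables: a word is a list of letters x^{±1}, and the normal
-- form of an expression is its freely reduced word.
module FreeGroupSolver {c ℓ} (G : Group c ℓ) where
  open Group G
  open import Algebra.Properties.Group G using (ε⁻¹≈ε; ⁻¹-involutive; ⁻¹-anti-homo-∙)
  open import Relation.Binary.Reasoning.Setoid setoid

  infixl 7 _⊛_

  data Expr (n : ℕ) : Set where
    var : Fin n → Expr n
    _⊛_ : Expr n → Expr n → Expr n
    inv : Expr n → Expr n

  ⟦_⟧ : ∀ {n} → Expr n → Vec Carrier n → Carrier
  ⟦ var x ⟧   ρ = lookup ρ x
  ⟦ e ⊛ e′ ⟧ ρ = ⟦ e ⟧ ρ ∙ ⟦ e′ ⟧ ρ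
  ⟦ inv e ⟧   ρ = ⟦ e ⟧ ρ ⁻¹

  -- the letter (x , true) stands for x, the letter (x , false) for x⁻¹
  Letter : ℕ → Set
  Letter n = Fin n × Bool

  flip : ∀ {n} → Letter n → Letter n
  flip (x , s) = x , not s

  cons : ∀ {n} → Letter n → List (Letter n) → List (Letter n)
  cons l [] = l ∷ []
  cons (x , s) ((y , t) ∷ w) with x ≟ y | s Bool.≟ not t
  ... | yes ≡.refl | yes ≡.refl = w
  ... | _        | _        = (x , s) ∷ (y , t) ∷ w

  invertOnto : ∀ {n} → List (Letter n) → List (Letter n) → List (Letter n)
  invertOnto []      acc = acc
  invertOnto (l ∷ w) acc = invertOnto w (flip l ∷ acc)

  normalise : ∀ {n} → Expr n → List (Letter n)
  normalise (var x)  = (x , true) ∷ []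
  normalise (e ⊛ e′) = foldr cons (normalise e′) (normalise e)
  normalise (inv e)  = invertOnto (normalise e) []

  module _ {n} (ρ : Vec Carrier n) where

    letter : Letter n → Carrier
    letter (x , true)  = lookup ρ x
    letter (x , false) = lookup ρ x ⁻¹

    word : List (Letter n) → Carrier
    word []      = ε
    word (l ∷ w) = letter l ∙ word w

    letter-flip : ∀ l → letter (flip l) ≈ letter l ⁻¹
    letter-flip (x , true)  = refl
    letter-flip (x , false) = sym (⁻¹-involutive _)

    flip-cancel : ∀ l u → letter (flip l) ∙ (letter l ∙ u) ≈ u
    flip-cancel l u = begin
      letter (flip l) ∙ (letter l ∙ u) ≈⟨ assoc _ _ _ ⟨
      (letter (flip l) ∙ letter l) ∙ u ≈⟨ ∙-congʳ (trans (∙-congʳ (letter-flip l)) (inverseˡ _)) ⟩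
      ε ∙ u                            ≈⟨ identityˡ u ⟩
      u                                ∎

    cons-sound : ∀ l w → word (cons l w) ≈ letter l ∙ word w
    cons-sound l [] = refl
    cons-sound (x , s) ((y , t) ∷ w) with x ≟ y | s Bool.≟ not t
    ... | yes ≡.refl | yes ≡.refl = sym (flip-cancel (y , t) (word w))
    ... | yes ≡.refl | no _     = refl
    ... | no _     | _        = refl

    foldr-cons-sound : ∀ u w → word (foldr cons w u) ≈ word u ∙ word w
    foldr-cons-sound []      w = sym (identityˡ _)
    foldr-cons-sound (l ∷ u) w = begin
      word (cons l (foldr cons w u))   ≈⟨ cons-sound l (foldr cons w u) ⟩
      letter l ∙ word (foldr cons w u) ≈⟨ ∙-congˡ (foldr-cons-sound u w) ⟩
      letter l ∙ (word u ∙ word w)     ≈⟨ assoc _ _ _ ⟨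
      (letter l ∙ word u) ∙ word w     ∎

    invertOnto-sound : ∀ u acc → word (invertOnto u acc) ≈ word u ⁻¹ ∙ word acc
    invertOnto-sound [] acc = begin
      word acc       ≈⟨ identityˡ _ ⟨
      ε ∙ word acc   ≈⟨ ∙-congʳ ε⁻¹≈ε ⟨
      ε ⁻¹ ∙ word acc ∎
    invertOnto-sound (l ∷ u) acc = begin
      word (invertOnto u (flip l ∷ acc))               ≈⟨ invertOnto-sound u _ ⟩
      word u ⁻¹ ∙ (letter (flip l) ∙ word acc)         ≈⟨ ∙-congˡ (∙-congʳ (letter-flip l)) ⟩
      word u ⁻¹ ∙ (letter l ⁻¹ ∙ word acc)             ≈⟨ assoc _ _ _ ⟨
      (word u ⁻¹ ∙ letter l ⁻¹) ∙ word acc             ≈⟨ ∙-congʳ (⁻¹-anti-homo-∙ _ _) ⟨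
      (letter l ∙ word u) ⁻¹ ∙ word acc                ∎

    normalise-sound : ∀ e → word (normalise e) ≈ ⟦ e ⟧ ρ
    normalise-sound (var x)  = identityʳ _
    normalise-sound (e ⊛ e′) =
      trans (foldr-cons-sound (normalise e) _) (∙-cong (normalise-sound e) (normalise-sound e′))
    normalise-sound (inv e)  = begin
      word (invertOnto (normalise e) []) ≈⟨ invertOnto-sound (normalise e) [] ⟩
      word (normalise e) ⁻¹ ∙ ε          ≈⟨ identityʳ _ ⟩
      word (normalise e) ⁻¹              ≈⟨ ⁻¹-cong (normalise-sound e) ⟩
      ⟦ e ⟧ ρ ⁻¹                         ∎

  solve : ∀ {n} (e e′ : Expr n) → normalise e ≡ normalise e′ →
          (ρ : Vec Carrier n) → ⟦ e ⟧ ρ ≈ ⟦ e′ ⟧ ρ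
  solve e e′ same ρ =
    trans (sym (normalise-sound ρ e)) (trans (reflexive (≡.cong (word ρ) same)) (normalise-sound ρ e′))

-- The commutator calculus used below: x ^ z = z⁻¹ x z (that is, x ⁅x,z⁆), the
-- Leibniz rules expressing the derivative of a product, inverse or commutator
-- through derivatives of the factors, and the three defects of the corollary.
module CommutatorIdentities {c ℓ} (G : Group c ℓ) where
  open Group G
  open FreeGroupSolver G

  ⁅_,_⁆ : Carrier → Carrier → Carrier
  ⁅_,_⁆ = ⟦_,_⟧ G

  infixl 6 _^_
  _^_ : Carrier → Carrier → Carrier
  x ^ z = x ∙ ⁅ x , z ⁆

  ⁅,⁆-cong : ∀ {x x′ y y′} → x ≈ x′ → y ≈ y′ → ⁅ x , y ⁆ ≈ ⁅ x′ , y′ ⁆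
  ⁅,⁆-cong x≈ y≈ = ∙-cong (∙-cong (∙-cong (⁻¹-cong x≈) (⁻¹-cong y≈)) x≈) y≈

  ^-cong : ∀ {x x′ z z′} → x ≈ x′ → z ≈ z′ → x ^ z ≈ x′ ^ z′
  ^-cong x≈ z≈ = ∙-cong x≈ (⁅,⁆-cong x≈ z≈)

  private
    ⁅_,_⁆ₑ : ∀ {n} → Expr n → Expr n → Expr n
    ⁅ a , b ⁆ₑ = ((inv a ⊛ inv b) ⊛ a) ⊛ b

    infixl 6 _^ₑ_
    _^ₑ_ : ∀ {n} → Expr n → Expr n → Expr n
    a ^ₑ z = a ⊛ ⁅ a , z ⁆ₑ

    -- a quotient  a′ a⁻¹  of a value at a shifted point by the value at n
    _/ₑ_ : ∀ {n} → Expr n → Expr n → Expr n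
    a′ /ₑ a = a′ ⊛ inv a

  ∂-product : ∀ a a′ b b′ →
    (a′ ∙ b′) ∙ (a ∙ b) ⁻¹ ≈ (a′ ∙ a ⁻¹) ∙ ((b′ ∙ b ⁻¹) ^ a ⁻¹)
  ∂-product a a′ b b′ = solve
    ((A′ ⊛ B′) /ₑ (A ⊛ B)) ((A′ /ₑ A) ⊛ ((B′ /ₑ B) ^ₑ inv A)) ≡.refl (a ∷ a′ ∷ b ∷ b′ ∷ [])
    where A = var 0F; A′ = var 1F; B = var 2F; B′ = var 3F

  ∂-inverse : ∀ a a′ → a′ ⁻¹ ∙ (a ⁻¹) ⁻¹ ≈ ((a′ ∙ a ⁻¹) ⁻¹) ^ a
  ∂-inverse a a′ = solve (inv A′ /ₑ inv A) (inv (A′ /ₑ A) ^ₑ A) ≡.refl (a ∷ a′ ∷ [])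
    where A = var 0F; A′ = var 1F

  -- Leibniz rule for commutators; with x = a′a⁻¹ and y = b′b⁻¹ every factor on
  -- the right is a commutator involving x or y
  ∂-commutator : ∀ a a′ b b′ → let x = a′ ∙ a ⁻¹; y = b′ ∙ b ⁻¹ in
    ⁅ a′ , b′ ⁆ ∙ ⁅ a , b ⁆ ⁻¹
      ≈ ((⁅ x , b ⁆ ∙ (⁅ x , y ⁆ ^ b)) ^ a) ∙ ((⁅ a , y ⁆ ^ b) ^ ⁅ a , b ⁆ ⁻¹)
  ∂-commutator a a′ b b′ = solve
    (⁅ A′ , B′ ⁆ₑ /ₑ ⁅ A , B ⁆ₑ)
    (((⁅ X , B ⁆ₑ ⊛ (⁅ X , Y ⁆ₑ ^ₑ B)) ^ₑ A) ⊛ ((⁅ A , Y ⁆ₑ ^ₑ B) ^ₑ inv ⁅ A , B ⁆ₑ))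
    ≡.refl (a ∷ a′ ∷ b ∷ b′ ∷ [])
    where A = var 0F; A′ = var 1F; B = var 2F; B′ = var 3F
          X = A′ /ₑ A; Y = B′ /ₑ B

  product-defect : ∀ a a′ b b′ →
    ((a′ ∙ b′) ∙ (a ∙ b) ⁻¹) ⁻¹ ∙ ((a′ ∙ a ⁻¹) ∙ (b′ ∙ b ⁻¹)) ≈ ⁅ a ⁻¹ , b′ ∙ b ⁻¹ ⁆
  product-defect a a′ b b′ = solve
    (inv ((A′ ⊛ B′) /ₑ (A ⊛ B)) ⊛ ((A′ /ₑ A) ⊛ (B′ /ₑ B))) ⁅ inv A , B′ /ₑ B ⁆ₑ
    ≡.refl (a ∷ a′ ∷ b ∷ b′ ∷ [])
    where A = var 0F; A′ = var 1F; B = var 2F; B′ = var 3F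

  -- with a = g(n), b = g(h n), c = g(h′ n), d = g(h h′ n):  ∂_{hh′} g and
  -- ∂_h g ∂_{h′} g differ by a conjugate of the inverse of the second
  -- derivative  ∂_{h′} ∂_h g (n) = (d c⁻¹)(b a⁻¹)⁻¹
  cocycle-defect : ∀ a b c d →
    (d ∙ a ⁻¹) ⁻¹ ∙ ((b ∙ a ⁻¹) ∙ (c ∙ a ⁻¹))
      ≈ (((d ∙ c ⁻¹) ∙ (b ∙ a ⁻¹) ⁻¹) ⁻¹) ^ ((b ∙ a ⁻¹) ∙ (c ∙ a ⁻¹))
  cocycle-defect a b c d = solve
    (inv (D /ₑ A) ⊛ ((B /ₑ A) ⊛ (C /ₑ A)))
    (inv ((D /ₑ C) /ₑ (B /ₑ A)) ^ₑ ((B /ₑ A) ⊛ (C /ₑ A)))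
    ≡.refl (a ∷ b ∷ c ∷ d ∷ [])
    where A = var 0F; B = var 1F; C = var 2F; D = var 3F

  swap-defect : ∀ u v → (u ∙ v) ⁻¹ ∙ (v ∙ u) ≈ ⁅ v , u ⁆
  swap-defect u v = solve (inv (U ⊛ V) ⊛ (V ⊛ U)) ⁅ V , U ⁆ₑ ≡.refl (u ∷ v ∷ [])
    where U = var 0F; V = var 1F

module OrderingFacts (O : Ordering) where
  open Ordering O
  open IsPartialOrder ≼-isPartialOrder public
    using () renaming (reflexive to ≼-reflexive; trans to ≼-trans)
  open IsCommutativeMonoid +-isCommutativeMonoid public
    using () renaming (assoc to +-assoc; comm to +-comm; identityˡ to +-identityˡ)

  +-commutativeSemigroup : CommutativeSemigroup 0ℓ 0ℓ
  +-commutativeSemigroup = record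
    { Carrier = I ; _≈_ = _≡_ ; _∙_ = _+_
    ; isCommutativeSemigroup = IsCommutativeMonoid.isCommutativeSemigroup +-isCommutativeMonoid }

  open import Algebra.Properties.CommutativeSemigroup +-commutativeSemigroup public
    using (xy∙z≈x∙zy; xy∙z≈yz∙x; xy∙z≈xz∙y)

  x≼x+y : ∀ x y → x ≼ (x + y)
  x≼x+y x y = ≼-trans (≼-reflexive (≡.sym (+-identityˡ x)))
    (≼-trans (+-mono x (0-minimal y)) (≼-reflexive (+-comm y x)))

  y≼x+y : ∀ x y → y ≼ (x + y)
  y≼x+y x y = ≼-trans (x≼x+y y x) (≼-reflexive (+-comm y x))

  +-monoʳ : ∀ {a b} d → a ≼ b → (d + a) ≼ (d + b)
  +-monoʳ {a} {b} d a≼b =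
    ≼-trans (≼-reflexive (+-comm d a)) (≼-trans (+-mono d a≼b) (≼-reflexive (+-comm b d)))

  degree-snoc : ∀ {a} {A : Set a} (hs : List (I × A)) k (h : A) →
    degree O (hs ++ [ (k , h) ]) ≡ degree O hs + k
  degree-snoc []             k h = +-comm k 0#
  degree-snoc ((k′ , _) ∷ hs) k h =
    ≡.trans (≡.cong (k′ +_) (degree-snoc hs k h)) (≡.sym (+-assoc k′ (degree O hs) k))

module PolynomialTerms {c ℓ c′ ℓ′ p q} (O : Ordering) (G : Group c ℓ) (H : Group c′ ℓ′)
  (FG : Filtration O G q) (FH : Filtration O H p) where
  open Ordering O
  open OrderingFacts O
  open CommutatorIdentities G
  private
    module G  = Group G
    module H  = Group H
    module FG = Filtration FG
    module FH = Filtration FH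
  open G using (_∙_; _⁻¹; _≈_)

  Map : Set (c ⊔ c′)
  Map = H.Carrier → G.Carrier

  Poly⁺ : I → Map → Set (c′ ⊔ p ⊔ q)
  Poly⁺ γ = Poly O {G = G} FH (shift O FG γ)

  Admissible : List (I × H.Carrier) → Set (c′ ⊔ p)
  Admissible = All (λ kh → proj₂ kh ∈ FH.F (proj₁ kh))

  ∂*-snoc : ∀ {A : Set} (hs : List (A × H.Carrier)) k h (g : Map) →
    ∂* H G (hs ++ [ (k , h) ]) g ≡ ∂* H G hs (∂ H G h g)
  ∂*-snoc []              k h g = ≡.refl
  ∂*-snoc ((_ , h′) ∷ hs) k h g = ≡.cong (∂ H G h′) (∂*-snoc hs k h g)

  ∂-poly : ∀ {γ k g h} → Poly⁺ γ g → h ∈ FH.F k → Poly⁺ (γ + k) (∂ H G h g)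
  ∂-poly {γ} {k} {g} {h} g-poly h∈ hs hs∈ n n∈ =
    ≡.subst₂ FG.F degree-eq (≡.cong-app (∂*-snoc hs k h g) n)
      (g-poly (hs ++ [ (k , h) ]) (++⁺ hs∈ (h∈ ∷ [])) n n∈)
    where
    degree-eq : degree O (hs ++ [ (k , h) ]) + γ ≡ degree O hs + (γ + k)
    degree-eq = ≡.trans (≡.cong (_+ γ) (degree-snoc hs k h)) (xy∙z≈x∙zy (degree O hs) k γ)

  infixl 7 _⊗_

  -- formal products, inverses and commutators of polynomial maps, indexed by
  -- a lower bound for their filtration degree
  data Term : I → Set (c ⊔ c′ ⊔ p ⊔ q) where
    atom : ∀ {γ} (g : Map) → Poly⁺ γ g → Term γ
    _⊗_  : ∀ {D} → Term D → Term D → Term D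
    inv  : ∀ {D} → Term D → Term D
    com  : ∀ {A B} → Term A → Term B → Term (A + B)
    wk   : ∀ {D E} → D ≼ E → Term E → Term D

  value : ∀ {D} → Term D → Map
  value (atom g _) = g
  value (s ⊗ t)  n = value s n ∙ value t n
  value (inv t)  n = value t n ⁻¹
  value (com s t) n = ⁅ value s n , value t n ⁆
  value (wk _ t)   = value t

  conj : ∀ {D E} → Term D → Term E → Term D
  conj {D} {E} u z = u ⊗ wk (x≼x+y D E) (com u z)

  value∈ : ∀ {D} (t : Term D) {n} → n ∈ FH.F 0# → value t n ∈ FG.F D
  value∈ (atom {γ} g g-poly) {n} n∈ =
    ≡.subst (λ d → g n ∈ FG.F d) (+-identityˡ γ) (g-poly [] [] n n∈)
  value∈ {D} (s ⊗ t) n∈ = IsSubgroup.∙∈ (FG.subgroup D) (value∈ s n∈) (value∈ t n∈)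
  value∈ {D} (inv t) n∈ = IsSubgroup.⁻¹∈ (FG.subgroup D) (value∈ t n∈)
  value∈ (com s t)   n∈ = FG.commutator (value∈ s n∈) (value∈ t n∈)
  value∈ (wk D≼E t)  n∈ = FG.antitone D≼E (value∈ t n∈)

  module _ (h : H.Carrier) {k} (h∈ : h ∈ FH.F k) where

    ∂-term : ∀ {D} → Term D → Term (D + k)
    ∂-term (atom g g-poly) = atom (∂ H G h g) (∂-poly g-poly h∈)
    ∂-term (s ⊗ t)         = ∂-term s ⊗ conj (∂-term t) (inv s)
    ∂-term (inv t)         = conj (inv (∂-term t)) t
    ∂-term (com {A} {B} s t) =
        conj (wk (≼-reflexive (xy∙z≈xz∙y A B k)) (com (∂-term s) t)
              ⊗ conj (wk A+B+k≼A+k+B+k (com (∂-term s) (∂-term t))) t) s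
      ⊗ conj (conj (wk (≼-reflexive (+-assoc A B k)) (com s (∂-term t))) t) (inv (com s t))
      where
      A+B+k≼A+k+B+k : ((A + B) + k) ≼ ((A + k) + (B + k))
      A+B+k≼A+k+B+k = ≼-trans (≼-reflexive (xy∙z≈xz∙y A B k)) (+-monoʳ (A + k) (x≼x+y B k))
    ∂-term (wk D≼E t)      = wk (+-mono k D≼E) (∂-term t)

    ∂-term-sound : ∀ {D} (t : Term D) n → ∂ H G h (value t) n ≈ value (∂-term t) n
    ∂-term-sound (atom g _) n = G.refl
    ∂-term-sound (s ⊗ t) n = G.trans (∂-product _ _ _ _)
      (G.∙-cong (∂-term-sound s n) (^-cong (∂-term-sound t n) G.refl))
    ∂-term-sound (inv t) n = G.trans (∂-inverse _ _)
      (^-cong (G.⁻¹-cong (∂-term-sound t n)) G.refl)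
    ∂-term-sound (com s t) n = G.trans (∂-commutator _ _ _ _)
      (G.∙-cong (^-cong (G.∙-cong (⁅,⁆-cong ∂s G.refl) (^-cong (⁅,⁆-cong ∂s ∂t) G.refl)) G.refl)
                (^-cong (^-cong (⁅,⁆-cong G.refl ∂t) G.refl) G.refl))
      where
      ∂s : ∂ H G h (value s) n ≈ value (∂-term s) n
      ∂s = ∂-term-sound s n
      ∂t : ∂ H G h (value t) n ≈ value (∂-term t) n
      ∂t = ∂-term-sound t n
    ∂-term-sound (wk _ t) n = ∂-term-sound t n

  Represents : ∀ {D} → Term D → Map → Set (c′ ⊔ ℓ)
  Represents t f = ∀ n → f n ≈ value t n

  ∂-represents : ∀ {D k h f} (h∈ : h ∈ FH.F k) (t : Term D) →
    Represents t f → Represents (∂-term h h∈ t) (∂ H G h f)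
  ∂-represents {h = h} h∈ t f≈t n =
    G.trans (G.∙-cong (f≈t (h H.∙ n)) (G.⁻¹-cong (f≈t n))) (∂-term-sound h h∈ t n)

  ∂*-term : ∀ {D} (hs : List (I × H.Carrier)) → Admissible hs → Term D → Term (degree O hs + D)
  ∂*-term {D} []             []          t = wk (≼-reflexive (+-identityˡ D)) t
  ∂*-term {D} ((k , h) ∷ hs) (h∈ ∷ hs∈) t =
    wk (≼-reflexive (xy∙z≈yz∙x k (degree O hs) D)) (∂-term h h∈ (∂*-term hs hs∈ t))

  ∂*-represents : ∀ {D f} (hs : List (I × H.Carrier)) (hs∈ : Admissible hs) (t : Term D) →
    Represents t f → Represents (∂*-term hs hs∈ t) (∂* H G hs f)
  ∂*-represents []             []          t f≈t = f≈t
  ∂*-represents ((k , h) ∷ hs) (h∈ ∷ hs∈) t f≈t =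
    ∂-represents h∈ (∂*-term hs hs∈ t) (∂*-represents hs hs∈ t f≈t)

  term-poly : ∀ {D f} (t : Term D) → Represents t f → Poly⁺ D f
  term-poly {D} t f≈t hs hs∈ n n∈ =
    IsSubgroup.resp (FG.subgroup (degree O hs + D)) (G.sym (∂*-represents hs hs∈ t f≈t n))
      (value∈ (∂*-term hs hs∈ t) n∈)

-- Corollary B.7.  The third congruence does not need H to be abelian: the
-- defect ⁅∂_k g_i, ∂_l g_i⁆ has degree (i + k) + (i + l) in any case.
corollaryB7 : ∀ {c ℓ c' ℓ' p q} (O : Ordering) (G : Group c ℓ) (H : Group c' ℓ')
    (FG : Filtration O G q) (FH : Filtration O H p)
    (i j k l : Ordering.I O)
    (gi gj : Group.Carrier H → Group.Carrier G)
    (hk hl : Group.Carrier H) →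
    Congruent G H gi → Congruent G H gj →
    Poly O {G = G} FH (shift O FG i) gi →
    Poly O {G = G} FH (shift O FG j) gj →
    hk ∈ Filtration.F FH k →
    hl ∈ Filtration.F FH l →
    ≡-mod-poly O FH FG (Ordering._+_ O (Ordering._+_ O i j) k)
      (∂ H G hk (_·_ H G gi gj)) (_·_ H G (∂ H G hk gi) (∂ H G hk gj))
    × ≡-mod-poly O FH FG (Ordering._+_ O (Ordering._+_ O i k) l)
      (∂ H G (Group._∙_ H hk hl) gi) (_·_ H G (∂ H G hk gi) (∂ H G hl gi))
    × (Commutative (Group._≈_ H) (Group._∙_ H) →
      ≡-mod-poly O FH FG (Ordering._+_ O (Ordering._+_ O i k) l)
        (_·_ H G (∂ H G hl gi) (∂ H G hk gi)) (_·_ H G (∂ H G hk gi) (∂ H G hl gi)))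
corollaryB7 O G H FG FH i j k l gi gj hk hl gi-cong _ gi-poly gj-poly hk∈ hl∈ =
    -- defect ⁅g_i⁻¹, ∂_k g_j⁆ of degree i + (j + k)
    term-poly (wk (≼-reflexive (+-assoc i j k)) (com (inv gᵢ) (∂-term hk hk∈ gⱼ)))
      (λ n → product-defect _ _ _ _)
    -- defect (∂_l ∂_k g_i)⁻¹ conjugated, of degree (i + k) + l; the point
    -- (h_k h_l) n is reassociated using that g_i respects equality
  , term-poly (conj (inv (∂-term hl hl∈ ∂ₖgᵢ)) (wk (x≼x+y i k) ∂ₖgᵢ ⊗ wk (x≼x+y i l) ∂ₗgᵢ))
      (λ n → Group.trans G
        (Group.∙-congʳ G (Group.⁻¹-cong G (Group.∙-congʳ G (gi-cong (Group.assoc H hk hl n)))))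
        (cocycle-defect _ _ _ _))
    -- defect ⁅∂_k g_i, ∂_l g_i⁆ of degree (i + k) + (i + l)
  , λ _ → term-poly (wk (+-monoʳ (i + k) (y≼x+y i l)) (com ∂ₖgᵢ ∂ₗgᵢ))
      (λ n → swap-defect _ _)
  where
  open Ordering O using (_+_)
  open OrderingFacts O
  open CommutatorIdentities G
  open PolynomialTerms O G H FG FH

  gᵢ : Term i
  gᵢ = atom gi gi-poly

  gⱼ : Term j
  gⱼ = atom gj gj-poly

  ∂ₖgᵢ : Term (i + k)
  ∂ₖgᵢ = ∂-term hk hk∈ gᵢ

  ∂ₗgᵢ : Term (i + l)
  ∂ₗgᵢ = ∂-term hl hl∈ gᵢ
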